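{- Let $X$ be an $n$-pseudomanifold such that $H^{n-1}(X;\mathbb{Z}_2)=0$. Then $$h^{n-1}(X)=\frac{2}{\operatorname{diam}(G_X)}.$$
   Context: An $n$-pseudomanifold is a finite pure $n$-dimensional simplicial complex in which every $(n-1)$-simplex lies in exactly two $n$-simplices and whose flip graph is connected. The flip graph $G_X$ has vertex set $X(n)$ and edges $\{\sigma,\sigma'\}$ with $\dim(\sigma\cap\sigma')=n-1$; $\operatorname{diam}$ is graph diameter. Cochains have $\mathbb{Z}_2$ coefficients; $\|\phi\|$ is the size of the support of $\phi$, $\|\phi\|_{csy}=\min_{\psi\in C^{k-1}(X)}\|\phi+d_{k-1}\psi\|$, and $h^k(X)=\min\{\|d_k\phi\|/\|\phi\|_{csy}:\phi\in C^k(X)\setminus B^k(X)\}$, where $B^k(X)=d_{k-1}C^{k-1}(X)$. -}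

module Defs where

open import Data.Nat using (ℕ; zero; suc; _≤_; _*_; _≡ᵇ_)
open import Data.Bool using (Bool; true; false; _xor_; _∧_; T)
open import Data.Fin using (Fin)
open import Data.Fin.Subset using (Subset; _⊆_; _∩_; ∣_∣; Nonempty; outside; inside)
open import Data.Fin.Subset.Properties using (_⊆?_)
open import Data.Vec as Vec using (lookup; _[_]≔_)
open import Data.List using (List; []; _∷_; map; filter; filterᵇ; length; foldr; allFin; _++_)
open import Data.Product using (Σ; ∃; ∃-syntax; _×_; _,_)
open import Relation.Nullary using (¬_)
open import Relation.Binary.PropositionalEquality using (_≡_)

allSubsets : ∀ n → List (Subset n)
allSubsets zero = Vec.[] ∷ []
allSubsets (suc n) = map (outside Vec.∷_) (allSubsets n) ++ map (inside Vec.∷_) (allSubsets n)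

record Complex (V : ℕ) : Set where
  field
    isFace   : Subset V → Bool
    nonempty : ∀ σ → T (isFace σ) → Nonempty σ
    closed   : ∀ σ τ → T (isFace σ) → τ ⊆ σ → Nonempty τ → T (isFace τ)
open Complex public

module _ {V : ℕ} (X : Complex V) where

  Simplex : ℕ → Subset V → Set
  Simplex k σ = T (isFace X σ) × ∣ σ ∣ ≡ suc k

  simplices : ℕ → List (Subset V)
  simplices k = filterᵇ (λ σ → isFace X σ ∧ (∣ σ ∣ ≡ᵇ suc k)) (allSubsets V)

  -- Flip graph G_X of the n-simplices.
  -- Two n-simplices are adjacent iff their intersection is an (n-1)-simplex,
  -- i.e. has exactly n vertices.
  Adjacent : ℕ → Subset V → Subset V → Set
  Adjacent n σ τ = ∣ σ ∩ τ ∣ ≡ n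

  -- Walks of length k in G_X (the start vertex is assumed to be an n-simplex
  -- wherever Walk is used; every later vertex is required to be one).
  data Walk (n : ℕ) : Subset V → Subset V → ℕ → Set where
    here : ∀ {σ} → Walk n σ σ 0
    step : ∀ {σ τ ρ k} → Simplex n τ → Adjacent n σ τ → Walk n τ ρ k → Walk n σ ρ (suc k)

  IsDiameter : ℕ → ℕ → Set
  IsDiameter n D =
    (∀ σ τ → Simplex n σ → Simplex n τ → ∃[ k ] (k ≤ D × Walk n σ τ k)) ×
    (∃[ σ ] ∃[ τ ] (Simplex n σ × Simplex n τ × (∀ k → Walk n σ τ k → D ≤ k)))

  record IsPseudomanifold (n : ℕ) : Set where
    field
      hasTop    : ∃[ τ ] Simplex n τ
      pure      : ∀ σ → T (isFace X σ) → ∃[ τ ] (Simplex n τ × σ ⊆ τ)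
      thin      : ∀ m → n ≡ suc m → ∀ σ → Simplex m σ →
                  length (filter (σ ⊆?_) (simplices n)) ≡ 2
      connected : ∀ σ τ → Simplex n σ → Simplex n τ → ∃[ k ] Walk n σ τ k

  -- Z₂-cochains: a cochain is a function on subsets; only its values on
  -- k-simplices matter for a k-cochain.
  Cochain : Set
  Cochain = Subset V → Bool

  _⊕_ : Cochain → Cochain → Cochain
  (φ ⊕ ψ) σ = φ σ xor ψ σ

  facets : Subset V → List (Subset V)
  facets τ = filterᵇ (isFace X) (map (λ i → τ [ i ]≔ outside) (filterᵇ (lookup τ) (allFin V)))

  -- coboundary d: (dφ)(τ) = Σ_{σ facet of τ} φ(σ)  (mod 2).
  -- For 0-simplices there are no facets in X, so d_{-1} = 0 (unreduced cohomology).
  d : Cochain → Cochain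
  d φ τ = foldr _xor_ false (map φ (facets τ))

  norm : ℕ → Cochain → ℕ
  norm k φ = length (filterᵇ φ (simplices k))

  IsCoboundary : ℕ → Cochain → Set
  IsCoboundary k φ = ∃[ ψ ] (∀ σ → Simplex k σ → φ σ ≡ d ψ σ)

  IsCocycle : ℕ → Cochain → Set
  IsCocycle k φ = ∀ τ → Simplex (suc k) τ → d φ τ ≡ false

  VanishingCohomology : ℕ → Set
  VanishingCohomology k = ∀ φ → IsCocycle k φ → IsCoboundary k φ

  IsCsyNorm : ℕ → Cochain → ℕ → Set
  IsCsyNorm k φ m = (∃[ ψ ] norm k (φ ⊕ d ψ) ≡ m) × (∀ ψ → m ≤ norm k (φ ⊕ d ψ))

  -- h^k(X) = p / q  (q > 0 intended), i.e. p/q is the minimum of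
  -- ‖dφ‖ / ‖φ‖_csy over φ ∈ C^k \ B^k  (cross-multiplied):
  -- p/q is a lower bound for all such ratios, and it is attained.
  CheegerIs : ℕ → ℕ → ℕ → Set
  CheegerIs k p q =
    (∀ φ → ¬ IsCoboundary k φ → ∀ m → IsCsyNorm k φ m →
       p * m ≤ q * norm (suc k) (d φ)) ×
    (∃[ φ ] (¬ IsCoboundary k φ × ∃[ m ] (IsCsyNorm k φ m ×
       p * m ≡ q * norm (suc k) (d φ))))

module Submission where

-- Walks in the flip graph and (n-1)-cochains correspond: by thinness, the
-- coboundary of the indicator δρ of a ridge ρ is δσ + δσ' for the two
-- n-simplices σ, σ' ⊇ ρ.  Hence a walk σ ⇝ τ of length k gives φ with
-- dφ = δσ + δτ and ‖φ‖ ≤ k, and conversely such a φ gives a walk σ ⇝ τ of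
-- length ≤ ‖φ‖ (peel off one ridge of the support at a time).
-- Lower bound: ‖dφ‖ is even; pairing up supp(dφ) by walks of length ≤ D gives
-- φ' with dφ' = dφ and 2‖φ'‖ ≤ D‖dφ‖, and φ + φ' is a coboundary, so
-- ‖φ‖_csy ≤ ‖φ'‖.  Attainment: for σ₀, τ₀ at distance D, the cochain of a
-- shortest walk has ‖dφ‖ = 2 and, by the converse and d ∘ d = 0, ‖φ‖_csy = D.

open import Defs
open import Data.Nat using (ℕ; zero; suc; _+_; _*_; _≤_; _<_; z≤n; s≤s; _≡ᵇ_)
open import Data.Nat.Properties
open import Data.Bool using (Bool; true; false; not; _∧_; _xor_; T; T?)
open import Data.Bool.Properties
  using (xor-assoc; xor-comm; xor-same; xor-identityʳ; ∧-identityʳ; ∧-zeroʳ; not-involutive; T-∧; T-≡)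
  renaming (_≟_ to _≟ᵇ_)
open import Data.Fin using (Fin; zero; suc)
import Data.Fin.Properties as Fin
open import Data.Fin.Subset using (Subset; _⊆_; _∩_; ∣_∣; Nonempty; inside; outside)
  renaming (_∈_ to _∈ₛ_)
open import Data.Fin.Subset.Properties
  using (_⊆?_; p⊆q⇒∣p∣≤∣q∣; drop-∷-⊆; p∩q⊆p; p∩q⊆q; x∈p∩q⁺; ∣p∩q∣≤∣p∣; ∩-idem)
open import Data.Vec using ([]; _∷_; lookup; _[_]≔_)
import Data.Vec as Vec
import Data.Vec.Properties as Vec
open import Data.List using (List; []; _∷_; map; filter; filterᵇ; length; foldr; allFin)
open import Data.List.Membership.Propositional using (_∈_)
open import Data.List.Membership.Propositional.Properties
  using (∈-filter⁺; ∈-filter⁻; ∈-map⁺; ∈-map⁻; ∈-++⁺ˡ; ∈-++⁺ʳ; ∈-allFin)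
open import Data.List.Relation.Unary.Any using (here; there)
open import Data.List.Relation.Unary.All using (All; []; _∷_) renaming (lookup to All-lookup; map to All-map)
open import Data.List.Relation.Unary.All.Properties using (all-filter)
open import Data.List.Relation.Unary.AllPairs using ([]; _∷_)
open import Data.List.Relation.Unary.Unique.Propositional using (Unique)
import Data.List.Relation.Unary.Unique.Propositional.Properties as Unique
open import Data.Product using (∃-syntax; _×_; _,_; proj₁; proj₂)
open import Data.Sum using (_⊎_; inj₁; inj₂)
open import Data.Empty using (⊥-elim)
open import Function.Bundles using (Equivalence)
open import Relation.Binary.PropositionalEquality
open import Relation.Binary.Definitions using (DecidableEquality)
open import Relation.Nullary using (¬_; Dec; yes; no; does)

xor-interchange : ∀ a b c e → (a xor b) xor (c xor e) ≡ (a xor c) xor (b xor e)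
xor-interchange a b c e = begin
  (a xor b) xor (c xor e)  ≡⟨ xor-assoc a b (c xor e) ⟩
  a xor (b xor (c xor e))  ≡⟨ cong (a xor_) (sym (xor-assoc b c e)) ⟩
  a xor ((b xor c) xor e)  ≡⟨ cong (λ z → a xor (z xor e)) (xor-comm b c) ⟩
  a xor ((c xor b) xor e)  ≡⟨ cong (a xor_) (xor-assoc c b e) ⟩
  a xor (c xor (b xor e))  ≡⟨ sym (xor-assoc a c (b xor e)) ⟩
  (a xor c) xor (b xor e)  ∎
  where open ≡-Reasoning

xor-cancel-middle : ∀ a b c → (a xor b) xor (b xor c) ≡ a xor c
xor-cancel-middle a b c = begin
  (a xor b) xor (b xor c)  ≡⟨ xor-assoc a b (b xor c) ⟩
  a xor (b xor (b xor c))  ≡⟨ cong (a xor_) (sym (xor-assoc b b c)) ⟩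
  a xor ((b xor b) xor c)  ≡⟨ cong (λ z → a xor (z xor c)) (xor-same b) ⟩
  a xor c                  ∎
  where open ≡-Reasoning

xor-cancel-left : ∀ a b c → (a xor b) xor (a xor c) ≡ c xor b
xor-cancel-left a b c = begin
  (a xor b) xor (a xor c)  ≡⟨ cong (_xor (a xor c)) (xor-comm a b) ⟩
  (b xor a) xor (a xor c)  ≡⟨ xor-cancel-middle b a c ⟩
  b xor c                  ≡⟨ xor-comm b c ⟩
  c xor b                  ∎
  where open ≡-Reasoning

parity : ℕ → Bool
parity zero    = false
parity (suc n) = not (parity n)

module _ {A : Set} where

  xorSum : (A → Bool) → List A → Bool
  xorSum f xs = foldr _xor_ false (map f xs)

  count : (A → Bool) → List A → ℕ
  count f xs = length (filterᵇ f xs)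

  parity-count : ∀ f xs → parity (count f xs) ≡ xorSum f xs
  parity-count f [] = refl
  parity-count f (x ∷ xs) with f x
  ... | true  = cong not (parity-count f xs)
  ... | false = parity-count f xs

  count-cong : ∀ {f g} xs → (∀ x → x ∈ xs → f x ≡ g x) → count f xs ≡ count g xs
  count-cong [] e = refl
  count-cong {f} {g} (x ∷ xs) e with f x | g x | e x (here refl)
  ... | true  | true  | _ = cong suc (count-cong xs (λ y p → e y (there p)))
  ... | false | false | _ = count-cong xs (λ y p → e y (there p))

  xorSum-cong : ∀ {f g} xs → (∀ x → x ∈ xs → f x ≡ g x) → xorSum f xs ≡ xorSum g xs
  xorSum-cong [] e = refl
  xorSum-cong (x ∷ xs) e = cong₂ _xor_ (e x (here refl)) (xorSum-cong xs (λ y p → e y (there p)))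

  count-xor : ∀ f g xs → count (λ x → f x xor g x) xs ≤ count f xs + count g xs
  count-xor f g [] = z≤n
  count-xor f g (x ∷ xs) with f x | g x
  ... | true  | true  = ≤-trans (count-xor f g xs) (≤-trans (+-monoʳ-≤ (count f xs) (n≤1+n _)) (n≤1+n _))
  ... | true  | false = s≤s (count-xor f g xs)
  ... | false | true  = ≤-trans (s≤s (count-xor f g xs)) (≤-reflexive (sym (+-suc _ _)))
  ... | false | false = count-xor f g xs

  count-zero : ∀ f xs → (∀ x → x ∈ xs → f x ≡ false) → count f xs ≡ 0
  count-zero f [] e = refl
  count-zero f (x ∷ xs) e with f x | e x (here refl)
  ... | false | _ = count-zero f xs (λ y p → e y (there p))

  xorSum-zero : ∀ f xs → (∀ x → x ∈ xs → f x ≡ false) → xorSum f xs ≡ false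
  xorSum-zero f [] e = refl
  xorSum-zero f (x ∷ xs) e rewrite e x (here refl) = xorSum-zero f xs (λ y p → e y (there p))

  xorSum-xor : ∀ f g xs → xorSum (λ x → f x xor g x) xs ≡ xorSum f xs xor xorSum g xs
  xorSum-xor f g [] = refl
  xorSum-xor f g (x ∷ xs) =
    trans (cong ((f x xor g x) xor_) (xorSum-xor f g xs))
          (xor-interchange (f x) (g x) (xorSum f xs) (xorSum g xs))

  xorSum-filter : ∀ g q xs → xorSum g (filterᵇ q xs) ≡ xorSum (λ x → q x ∧ g x) xs
  xorSum-filter g q [] = refl
  xorSum-filter g q (x ∷ xs) with q x
  ... | true  = cong (g x xor_) (xorSum-filter g q xs)
  ... | false = xorSum-filter g q xs

  ∧-xorSum : ∀ b f xs → b ∧ xorSum f xs ≡ xorSum (λ x → b ∧ f x) xs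
  ∧-xorSum true  f xs = refl
  ∧-xorSum false f xs = sym (xorSum-zero _ xs (λ _ _ → refl))

  xorSum-witness : ∀ f xs → xorSum f xs ≡ true → ∃[ x ] (x ∈ xs × f x ≡ true)
  xorSum-witness f [] ()
  xorSum-witness f (x ∷ xs) e with f x in fx
  ... | true  = x , here refl , fx
  ... | false with xorSum-witness f xs e
  ...   | y , y∈ , fy = y , there y∈ , fy

  -- A double sum of a symmetric kernel vanishing on the diagonal is zero:
  -- the off-diagonal terms cancel in pairs.  This is the heart of d ∘ d = 0.
  xorSum-symmetric : ∀ (H : A → A → Bool) → (∀ i j → H i j ≡ H j i) → (∀ i → H i i ≡ false) →
                     ∀ xs → xorSum (λ i → xorSum (H i) xs) xs ≡ false
  xorSum-symmetric H sym-H diag [] = refl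
  xorSum-symmetric H sym-H diag (x ∷ xs) = begin
      (H x x xor row) xor xorSum (λ i → H i x xor xorSum (H i) xs) xs
    ≡⟨ cong₂ (λ u v → (u xor row) xor v) (diag x) (xorSum-xor (λ i → H i x) (λ i → xorSum (H i) xs) xs) ⟩
      row xor (xorSum (λ i → H i x) xs xor rest)
    ≡⟨ cong (λ u → row xor (u xor rest)) (xorSum-cong xs (λ i _ → sym-H i x)) ⟩
      row xor (row xor rest)
    ≡⟨ sym (xor-assoc row row rest) ⟩
      (row xor row) xor rest
    ≡⟨ cong (_xor rest) (xor-same row) ⟩
      rest
    ≡⟨ xorSum-symmetric H sym-H diag xs ⟩
      false
    ∎
    where
    open ≡-Reasoning
    row rest : Bool
    row  = xorSum (H x) xs
    rest = xorSum (λ i → xorSum (H i) xs) xs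

xorSum-map : ∀ {A B : Set} (g : B → Bool) (h : A → B) xs →
             xorSum g (map h xs) ≡ xorSum (λ x → g (h x)) xs
xorSum-map g h [] = refl
xorSum-map g h (x ∷ xs) = cong (g (h x) xor_) (xorSum-map g h xs)

module Indicator {A : Set} (_≟_ : DecidableEquality A) where

  _==_ : A → A → Bool
  x == y = does (x ≟ y)

  δ : A → A → Bool
  δ a x = x == a

  ==-refl : ∀ x → (x == x) ≡ true
  ==-refl x with x ≟ x
  ... | yes _ = refl
  ... | no x≢x = ⊥-elim (x≢x refl)

  ==-≢ : ∀ {x y} → ¬ x ≡ y → (x == y) ≡ false
  ==-≢ {x} {y} x≢y with x ≟ y
  ... | yes x≡y = ⊥-elim (x≢y x≡y)
  ... | no _ = refl

  ==-sym : ∀ x y → (x == y) ≡ (y == x)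
  ==-sym x y with x ≟ y | y ≟ x
  ... | yes _   | yes _   = refl
  ... | no _    | no _    = refl
  ... | yes x≡y | no y≢x = ⊥-elim (y≢x (sym x≡y))
  ... | no x≢y  | yes y≡x = ⊥-elim (x≢y (sym y≡x))

  private
    distinct : ∀ {y ys x} → All (λ z → ¬ y ≡ z) ys → x ∈ ys → (x == y) ≡ false
    distinct y∉ys x∈ys = ==-≢ (λ x≡y → All-lookup y∉ys x∈ys (sym x≡y))

  xorSum-pick : ∀ (f : A → Bool) {x} xs → Unique xs → x ∈ xs → xorSum (λ s → f s ∧ (x == s)) xs ≡ f x
  xorSum-pick f (y ∷ ys) (y∉ys ∷ u) (here refl) =
    trans (cong₂ _xor_ (trans (cong (f y ∧_) (==-refl y)) (∧-identityʳ (f y)))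
                       (xorSum-zero _ ys (λ s s∈ → trans (cong (f s ∧_) (trans (==-sym y s) (distinct y∉ys s∈)))
                                                         (∧-zeroʳ (f s)))))
          (xor-identityʳ (f y))
  xorSum-pick f {x} (y ∷ ys) (y∉ys ∷ u) (there x∈ys) =
    cong₂ _xor_ (trans (cong (f y ∧_) (distinct y∉ys x∈ys)) (∧-zeroʳ (f y))) (xorSum-pick f ys u x∈ys)

  count-δ≤1 : ∀ a xs → Unique xs → count (δ a) xs ≤ 1
  count-δ≤1 a [] u = z≤n
  count-δ≤1 a (y ∷ ys) (y∉ys ∷ u) with y ≟ a
  ... | yes refl = s≤s (≤-reflexive (count-zero (δ y) ys (λ s s∈ → distinct y∉ys s∈)))
  ... | no _     = count-δ≤1 a ys u

  count-remove : ∀ (f : A → Bool) {a} xs → Unique xs → a ∈ xs → f a ≡ true →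
                 suc (count (λ x → f x xor δ a x) xs) ≡ count f xs
  count-remove f (y ∷ ys) (y∉ys ∷ u) (here refl) fa rewrite ==-refl y | fa =
    cong suc (count-cong ys (λ s s∈ → trans (cong (f s xor_) (distinct y∉ys s∈)) (xor-identityʳ (f s))))
  count-remove f {a} (y ∷ ys) (y∉ys ∷ u) (there a∈ys) fa
    rewrite ==-≢ {y} {a} (λ y≡a → All-lookup y∉ys a∈ys y≡a) | xor-identityʳ (f y) with f y
  ... | true  = cong suc (count-remove f ys u a∈ys fa)
  ... | false = count-remove f ys u a∈ys fa

  count-δ-pair : ∀ {a b} xs → Unique xs → a ∈ xs → b ∈ xs → ¬ a ≡ b →
                 count (λ x → δ a x xor δ b x) xs ≡ 2
  count-δ-pair {a} {b} xs u a∈ b∈ a≢b = begin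
      count (λ x → δ a x xor δ b x) xs
    ≡⟨ sym (count-remove (λ x → δ a x xor δ b x) xs u b∈
             (cong₂ _xor_ (==-≢ (λ b≡a → a≢b (sym b≡a))) (==-refl b))) ⟩
      suc (count (λ x → (δ a x xor δ b x) xor δ b x) xs)
    ≡⟨ cong suc (count-cong xs (λ x _ → trans (xor-assoc (δ a x) _ _)
                   (trans (cong (δ a x xor_) (xor-same (δ b x))) (xor-identityʳ _)))) ⟩
      suc (count (δ a) xs)
    ≡⟨ cong suc (sym (count-remove (δ a) xs u a∈ (==-refl a))) ⟩
      suc (suc (count (λ x → δ a x xor δ a x) xs))
    ≡⟨ cong (λ z → suc (suc z)) (count-zero _ xs (λ x _ → xor-same (δ a x))) ⟩
      2
    ∎
    where open ≡-Reasoning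

  χ : List A → A → Bool
  χ S x = xorSum (λ s → x == s) S

  χ-support : ∀ (f : A → Bool) {x} xs → Unique xs → x ∈ xs → χ (filterᵇ f xs) x ≡ f x
  χ-support f xs u x∈ = trans (xorSum-filter _ f xs) (xorSum-pick f xs u x∈)

_≟S_ : ∀ {n} → DecidableEquality (Subset n)
_≟S_ = Vec.≡-dec _≟ᵇ_

allSubsets-complete : ∀ n (p : Subset n) → p ∈ allSubsets n
allSubsets-complete zero [] = here refl
allSubsets-complete (suc n) (false ∷ p) = ∈-++⁺ˡ (∈-map⁺ (false ∷_) (allSubsets-complete n p))
allSubsets-complete (suc n) (true ∷ p) =
  ∈-++⁺ʳ (map (outside ∷_) (allSubsets n)) (∈-map⁺ (true ∷_) (allSubsets-complete n p))

allSubsets-unique : ∀ n → Unique (allSubsets n)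
allSubsets-unique zero = [] ∷ []
allSubsets-unique (suc n) =
  Unique.++⁺ (Unique.map⁺ Vec.∷-injectiveʳ (allSubsets-unique n))
             (Unique.map⁺ Vec.∷-injectiveʳ (allSubsets-unique n)) disjoint
  where
  disjoint : ∀ {v} → ¬ (v ∈ map (outside ∷_) (allSubsets n) × v ∈ map (inside ∷_) (allSubsets n))
  disjoint (p , q) with ∈-map⁻ (outside ∷_) p | ∈-map⁻ (inside ∷_) q
  ... | _ , _ , refl | _ , _ , ()

_-_ : ∀ {V} → Subset V → Fin V → Subset V
p - i = p [ i ]≔ outside

∈⇒lookup : ∀ {n} {p : Subset n} {x} → x ∈ₛ p → lookup p x ≡ true
∈⇒lookup = Vec.[]=⇒lookup

lookup⇒∈ : ∀ {n} {p : Subset n} {x} → lookup p x ≡ true → x ∈ₛ p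
lookup⇒∈ {p = p} {x} = Vec.lookup⇒[]= x p

∣p-i∣ : ∀ {n} (p : Subset n) i → lookup p i ≡ true → suc ∣ p - i ∣ ≡ ∣ p ∣
∣p-i∣ (true ∷ p)  zero    e = refl
∣p-i∣ (true ∷ p)  (suc i) e = cong suc (∣p-i∣ p i e)
∣p-i∣ (false ∷ p) (suc i) e = ∣p-i∣ p i e

p-i⊆p : ∀ {n} (p : Subset n) i → (p - i) ⊆ p
p-i⊆p p i {x} x∈ with x Fin.≟ i
... | yes refl with () ← trans (sym (∈⇒lookup x∈)) (Vec.lookup∘update i p false)
... | no x≢i = lookup⇒∈ (trans (sym (Vec.lookup∘update′ x≢i p false)) (∈⇒lookup x∈))

⊆-p-i : ∀ {n} {q p : Subset n} i → q ⊆ p → lookup q i ≡ false → q ⊆ (p - i)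
⊆-p-i {q = q} {p} i q⊆p qi {x} x∈ with x Fin.≟ i
... | yes refl with () ← trans (sym (∈⇒lookup x∈)) qi
... | no x≢i = lookup⇒∈ (trans (Vec.lookup∘update′ x≢i p false) (∈⇒lookup (q⊆p x∈)))

-p-injective : ∀ {n} (p : Subset n) {i j} → lookup p i ≡ true → lookup p j ≡ true → p - i ≡ p - j → i ≡ j
-p-injective p {i} {j} pi pj e with i Fin.≟ j
... | yes i≡j = i≡j
... | no i≢j with () ← trans (sym pi) (trans (sym (Vec.lookup∘update′ i≢j p false))
                        (trans (cong (λ z → lookup z i) (sym e)) (Vec.lookup∘update i p false)))

⊆-size-≡ : ∀ {n} {p q : Subset n} → p ⊆ q → ∣ p ∣ ≡ ∣ q ∣ → p ≡ q
⊆-size-≡ {p = []} {[]} s e = refl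
⊆-size-≡ {p = true ∷ p} {true ∷ q} s e = cong (true ∷_) (⊆-size-≡ (drop-∷-⊆ s) (suc-injective e))
⊆-size-≡ {p = true ∷ p} {false ∷ q} s e with () ← Vec.[]=⇒lookup (s {zero} Vec.here)
⊆-size-≡ {p = false ∷ p} {false ∷ q} s e = cong (false ∷_) (⊆-size-≡ (drop-∷-⊆ s) e)
⊆-size-≡ {p = false ∷ p} {true ∷ q} s e =
  ⊥-elim (<-irrefl refl (≤-trans (≤-reflexive (sym e)) (p⊆q⇒∣p∣≤∣q∣ (drop-∷-⊆ s))))

⊆-size-<-missing : ∀ {n} {p q : Subset n} → p ⊆ q → ∣ p ∣ < ∣ q ∣ →
                   ∃[ i ] (lookup q i ≡ true × lookup p i ≡ false)
⊆-size-<-missing {p = []} {[]} s ()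
⊆-size-<-missing {p = true ∷ p} {true ∷ q} s lt with ⊆-size-<-missing (drop-∷-⊆ s) (≤-pred lt)
... | i , qi , pi = suc i , qi , pi
⊆-size-<-missing {p = true ∷ p} {false ∷ q} s lt with () ← Vec.[]=⇒lookup (s {zero} Vec.here)
⊆-size-<-missing {p = false ∷ p} {false ∷ q} s lt with ⊆-size-<-missing (drop-∷-⊆ s) lt
... | i , qi , pi = suc i , qi , pi
⊆-size-<-missing {p = false ∷ p} {true ∷ q} s lt = zero , refl , refl

size-suc⇒nonempty : ∀ {n} (p : Subset n) {k} → ∣ p ∣ ≡ suc k → Nonempty p
size-suc⇒nonempty (true ∷ p)  e = zero , Vec.here
size-suc⇒nonempty (false ∷ p) e with size-suc⇒nonempty p e
... | i , i∈p = suc i , Vec.there i∈p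

shared-facet⇒adjacent : ∀ {n k} {ρ σ σ' : Subset n} → ∣ ρ ∣ ≡ k → ∣ σ ∣ ≡ suc k → ∣ σ' ∣ ≡ suc k →
                        ρ ⊆ σ → ρ ⊆ σ' → ¬ σ ≡ σ' → ∣ σ ∩ σ' ∣ ≡ k
shared-facet⇒adjacent {k = k} {ρ} {σ} {σ'} ∣ρ∣ ∣σ∣ ∣σ'∣ ρ⊆σ ρ⊆σ' σ≢σ' =
  ≤-antisym (≤-pred (≤∧≢⇒< at-most-suc not-suc)) at-least
  where
  at-least : k ≤ ∣ σ ∩ σ' ∣
  at-least = subst (_≤ ∣ σ ∩ σ' ∣) ∣ρ∣ (p⊆q⇒∣p∣≤∣q∣ (λ x∈ρ → x∈p∩q⁺ (ρ⊆σ x∈ρ , ρ⊆σ' x∈ρ)))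
  at-most-suc : ∣ σ ∩ σ' ∣ ≤ suc k
  at-most-suc = subst (∣ σ ∩ σ' ∣ ≤_) ∣σ∣ (∣p∩q∣≤∣p∣ σ σ')
  not-suc : ¬ ∣ σ ∩ σ' ∣ ≡ suc k
  not-suc full = σ≢σ' (⊆-size-≡ σ⊆σ' (trans ∣σ∣ (sym ∣σ'∣)))
    where
    σ∩σ'≡σ : σ ∩ σ' ≡ σ
    σ∩σ'≡σ = ⊆-size-≡ (p∩q⊆p σ σ') (trans full (sym ∣σ∣))
    σ⊆σ' : σ ⊆ σ'
    σ⊆σ' x∈σ = p∩q⊆q σ σ' (subst (_ ∈ₛ_) (sym σ∩σ'≡σ) x∈σ)

pair-exhaust : ∀ {A : Set} {xs : List A} → length xs ≡ 2 →
               ∀ {x y z} → x ∈ xs → y ∈ xs → ¬ x ≡ y → z ∈ xs → z ≡ x ⊎ z ≡ y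
pair-exhaust {xs = a ∷ b ∷ []} _ (here refl) (here refl) x≢y _ = ⊥-elim (x≢y refl)
pair-exhaust {xs = a ∷ b ∷ []} _ (here refl) (there (here refl)) _ (here refl) = inj₁ refl
pair-exhaust {xs = a ∷ b ∷ []} _ (here refl) (there (here refl)) _ (there (here refl)) = inj₂ refl
pair-exhaust {xs = a ∷ b ∷ []} _ (there (here refl)) (here refl) _ (here refl) = inj₂ refl
pair-exhaust {xs = a ∷ b ∷ []} _ (there (here refl)) (here refl) _ (there (here refl)) = inj₁ refl
pair-exhaust {xs = a ∷ b ∷ []} _ (there (here refl)) (there (here refl)) x≢y _ = ⊥-elim (x≢y refl)

pair-partner : ∀ {A : Set} {xs : List A} → length xs ≡ 2 → Unique xs →
               ∀ {x} → x ∈ xs → ∃[ y ] (y ∈ xs × ¬ x ≡ y)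
pair-partner {xs = a ∷ b ∷ []} _ ((a≢b ∷ []) ∷ _) (here refl) = b , there (here refl) , a≢b
pair-partner {xs = a ∷ b ∷ []} _ ((a≢b ∷ []) ∷ _) (there (here refl)) = a , here refl , λ b≡a → a≢b (sym b≡a)

pair-members : ∀ {A : Set} {xs : List A} → length xs ≡ 2 → Unique xs →
               ∃[ x ] ∃[ y ] (x ∈ xs × y ∈ xs × ¬ x ≡ y)
pair-members {xs = a ∷ b ∷ []} _ ((a≢b ∷ []) ∷ _) = a , b , here refl , there (here refl) , a≢b

map-unique : ∀ {A B : Set} (f : A → B) (P : A → Set) →
             (∀ {x y} → P x → P y → f x ≡ f y → x ≡ y) →
             ∀ xs → All P xs → Unique xs → Unique (map f xs)
map-unique f P inj [] _ _ = []
map-unique f P inj (x ∷ xs) (px ∷ pxs) (x∉xs ∷ u) = fresh xs pxs x∉xs ∷ map-unique f P inj xs pxs u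
  where
  fresh : ∀ ys → All P ys → All (λ y → ¬ x ≡ y) ys → All (λ z → ¬ f x ≡ z) (map f ys)
  fresh [] _ _ = []
  fresh (y ∷ ys) (py ∷ pys) (x≢y ∷ x∉ys) = (λ e → x≢y (inj px py e)) ∷ fresh ys pys x∉ys

module Coboundary {V : ℕ} (K : Complex V) where

  open Indicator (_≟S_ {V}) public

  simplex-∈ : ∀ {k σ} → Simplex K k σ → σ ∈ simplices K k
  simplex-∈ {k} {σ} (face , size) =
    ∈-filter⁺ (λ x → T? (isFace K x ∧ (∣ x ∣ ≡ᵇ suc k))) (allSubsets-complete V σ)
              (Equivalence.from T-∧ (face , ≡⇒≡ᵇ _ _ size))

  ∈-simplex : ∀ {k σ} → σ ∈ simplices K k → Simplex K k σ
  ∈-simplex {k} {σ} σ∈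
    with Equivalence.to T-∧ (proj₂ (∈-filter⁻ (λ x → T? (isFace K x ∧ (∣ x ∣ ≡ᵇ suc k))) {xs = allSubsets V} σ∈))
  ... | face , size = face , ≡ᵇ⇒≡ _ _ size

  support-simplex : ∀ {k} (f : Cochain K) {σ} → σ ∈ filterᵇ f (simplices K k) → Simplex K k σ
  support-simplex {k} f σ∈ = ∈-simplex (proj₁ (∈-filter⁻ (λ x → T? (f x)) {xs = simplices K k} σ∈))

  simplices-unique : ∀ k → Unique (simplices K k)
  simplices-unique k = Unique.filter⁺ _ (allSubsets-unique V)

  facet-shape : ∀ {τ ρ} → ρ ∈ facets K τ → ∃[ i ] (lookup τ i ≡ true × ρ ≡ τ - i × T (isFace K ρ))
  facet-shape {τ} {ρ} ρ∈
    with ∈-filter⁻ (λ x → T? (isFace K x)) {xs = map (τ -_) (filterᵇ (lookup τ) (allFin V))} ρ∈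
  ... | ρ∈map , face with ∈-map⁻ (τ -_) ρ∈map
  ... | i , i∈ , refl = i , Equivalence.to T-≡ (proj₂ (∈-filter⁻ (λ x → T? (lookup τ x)) {xs = allFin V} i∈)) , refl , face

  facet-⊆ : ∀ {τ ρ} → ρ ∈ facets K τ → ρ ⊆ τ
  facet-⊆ {τ} ρ∈ with facet-shape ρ∈
  ... | i , _ , refl , _ = p-i⊆p τ i

  facet-simplex : ∀ {k τ ρ} → Simplex K (suc k) τ → ρ ∈ facets K τ → Simplex K k ρ
  facet-simplex {τ = τ} (_ , size) ρ∈ with facet-shape ρ∈
  ... | i , τi , refl , face = face , suc-injective (trans (∣p-i∣ τ i τi) size)

  facets-unique : ∀ τ → Unique (facets K τ)
  facets-unique τ =
    Unique.filter⁺ _ (map-unique (τ -_) (λ i → lookup τ i ≡ true) (-p-injective τ)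
                        _ (All-map (Equivalence.to T-≡) (all-filter (λ i → T? (lookup τ i)) (allFin V)))
                        (Unique.filter⁺ _ (Unique.allFin⁺ V)))

  facet-intro : ∀ {k ρ τ} → Simplex K k ρ → Simplex K (suc k) τ → ρ ⊆ τ → ρ ∈ facets K τ
  facet-intro {k} {ρ} {τ} (ρ-face , ρ-size) (_ , τ-size) ρ⊆τ
    with ⊆-size-<-missing ρ⊆τ (subst₂ _<_ (sym ρ-size) (sym τ-size) (n<1+n (suc k)))
  ... | i , τi , ρi = subst (_∈ facets K τ) (sym ρ≡τ-i) τ-i∈
    where
    ρ≡τ-i : ρ ≡ τ - i
    ρ≡τ-i = ⊆-size-≡ (⊆-p-i i ρ⊆τ ρi) (trans ρ-size (sym (suc-injective (trans (∣p-i∣ τ i τi) τ-size))))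
    τ-i∈ : τ - i ∈ facets K τ
    τ-i∈ = ∈-filter⁺ (λ x → T? (isFace K x))
             (∈-map⁺ (τ -_) (∈-filter⁺ (λ x → T? (lookup τ x)) (∈-allFin i) (Equivalence.from T-≡ τi)))
             (subst (λ z → T (isFace K z)) ρ≡τ-i ρ-face)

  d-xor : ∀ (φ ψ : Cochain K) τ → d K (λ x → φ x xor ψ x) τ ≡ d K φ τ xor d K ψ τ
  d-xor φ ψ τ = xorSum-xor φ ψ (facets K τ)

  d-zero : ∀ τ → d K (λ _ → false) τ ≡ false
  d-zero τ = xorSum-zero _ (facets K τ) (λ _ _ → refl)

  d-local : ∀ {k} {φ ψ : Cochain K} {τ} → (∀ ρ → Simplex K k ρ → φ ρ ≡ ψ ρ) →
            Simplex K (suc k) τ → d K φ τ ≡ d K ψ τ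
  d-local {τ = τ} φ≗ψ τ-simplex = xorSum-cong (facets K τ) (λ ρ ρ∈ → φ≗ψ ρ (facet-simplex τ-simplex ρ∈))

  d-δ : ∀ {k ρ τ} → Simplex K k ρ → Simplex K (suc k) τ → d K (δ ρ) τ ≡ does (ρ ⊆? τ)
  d-δ {k} {ρ} {τ} ρ-simplex τ-simplex with ρ ⊆? τ
  ... | yes ρ⊆τ = trans (xorSum-cong (facets K τ) (λ s _ → ==-sym s ρ))
                        (xorSum-pick (λ _ → true) (facets K τ) (facets-unique τ) (facet-intro ρ-simplex τ-simplex ρ⊆τ))
  ... | no ρ⊈τ =
    xorSum-zero _ (facets K τ) (λ s s∈ → ==-≢ (λ s≡ρ → ρ⊈τ (subst (_⊆ τ) s≡ρ (facet-⊆ s∈))))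

  face-minus : ∀ {j τ} i → T (isFace K τ) → ∣ τ ∣ ≡ suc (suc j) → lookup τ i ≡ true →
               isFace K (τ - i) ≡ true
  face-minus {j} {τ} i face size τi =
    Equivalence.to T-≡ (closed K τ (τ - i) face (p-i⊆p τ i)
           (size-suc⇒nonempty (τ - i) (suc-injective (trans (∣p-i∣ τ i τi) size))))

  d-expand : ∀ (φ : Cochain K) τ →
             d K φ τ ≡ xorSum (λ i → lookup τ i ∧ (isFace K (τ - i) ∧ φ (τ - i))) (allFin V)
  d-expand φ τ =
    trans (xorSum-filter φ (isFace K) (map (τ -_) vertices))
          (trans (xorSum-map (λ ρ → isFace K ρ ∧ φ ρ) (τ -_) vertices) (xorSum-filter _ (lookup τ) (allFin V)))
    where
    vertices : List (Fin V)
    vertices = filterᵇ (lookup τ) (allFin V)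

  -- The kernel (i, j) ↦ [i ∈ τ] [j ∈ τ - i] G(τ - i - j) of the double sum
  -- in d(dψ)τ is symmetric, because removing two vertices commutes.
  removal-kernel-symmetric : ∀ (G : Subset V → Bool) τ i j →
    lookup τ i ∧ (lookup (τ - i) j ∧ G ((τ - i) - j)) ≡ lookup τ j ∧ (lookup (τ - j) i ∧ G ((τ - j) - i))
  removal-kernel-symmetric G τ i j with i Fin.≟ j
  ... | yes refl = refl
  ... | no i≢j = begin
      lookup τ i ∧ (lookup (τ - i) j ∧ G ((τ - i) - j))
    ≡⟨ cong₂ (λ u v → lookup τ i ∧ (u ∧ G v)) (Vec.lookup∘update′ (λ j≡i → i≢j (sym j≡i)) τ false)
                                              (Vec.[]≔-commutes τ i j i≢j) ⟩
      lookup τ i ∧ (lookup τ j ∧ G ((τ - j) - i))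
    ≡⟨ ∧-swap (lookup τ i) (lookup τ j) _ ⟩
      lookup τ j ∧ (lookup τ i ∧ G ((τ - j) - i))
    ≡⟨ cong (λ u → lookup τ j ∧ (u ∧ G ((τ - j) - i))) (sym (Vec.lookup∘update′ i≢j τ false)) ⟩
      lookup τ j ∧ (lookup (τ - j) i ∧ G ((τ - j) - i))
    ∎
    where
    open ≡-Reasoning
    ∧-swap : ∀ a b c → a ∧ (b ∧ c) ≡ b ∧ (a ∧ c)
    ∧-swap false false c = refl
    ∧-swap false true  c = refl
    ∧-swap true  b     c = refl

  d∘d : ∀ {j} (ψ : Cochain K) τ → T (isFace K τ) → ∣ τ ∣ ≡ suc (suc j) → d K (d K ψ) τ ≡ false
  d∘d {j} ψ τ face size = begin
      d K (d K ψ) τ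
    ≡⟨ d-expand (d K ψ) τ ⟩
      xorSum (λ i → lookup τ i ∧ (isFace K (τ - i) ∧ d K ψ (τ - i))) vertices
    ≡⟨ xorSum-cong vertices (λ i _ → drop-face-test i) ⟩
      xorSum (λ i → lookup τ i ∧ d K ψ (τ - i)) vertices
    ≡⟨ xorSum-cong vertices (λ i _ → trans (cong (lookup τ i ∧_) (d-expand ψ (τ - i)))
                                           (∧-xorSum (lookup τ i) _ vertices)) ⟩
      xorSum (λ i → xorSum (H i) vertices) vertices
    ≡⟨ xorSum-symmetric H (removal-kernel-symmetric G τ) H-diagonal vertices ⟩
      false
    ∎
    where
    open ≡-Reasoning
    vertices : List (Fin V)
    vertices = allFin V
    G : Subset V → Bool
    G ρ = isFace K ρ ∧ ψ ρ
    H : Fin V → Fin V → Bool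
    H i j = lookup τ i ∧ (lookup (τ - i) j ∧ G ((τ - i) - j))
    drop-face-test : ∀ i → lookup τ i ∧ (isFace K (τ - i) ∧ d K ψ (τ - i)) ≡ lookup τ i ∧ d K ψ (τ - i)
    drop-face-test i with lookup τ i in τi
    ... | false = refl
    ... | true  = cong (_∧ d K ψ (τ - i)) (face-minus i face size τi)
    H-diagonal : ∀ i → H i i ≡ false
    H-diagonal i = trans (cong (λ u → lookup τ i ∧ (u ∧ G ((τ - i) - i))) (Vec.lookup∘update i τ false))
                         (∧-zeroʳ (lookup τ i))

module Pseudomanifold {V : ℕ} (K : Complex V) (m : ℕ) (pm : IsPseudomanifold K (suc m)) where

  open Coboundary K public

  Top Ridges : List (Subset V)
  Top    = simplices K (suc m)
  Ridges = simplices K m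

  _≗ₙ_ : Cochain K → Cochain K → Set
  f ≗ₙ g = ∀ σ → Simplex K (suc m) σ → f σ ≡ g σ

  cofaces : Subset V → List (Subset V)
  cofaces ρ = filter (ρ ⊆?_) Top

  cofaces-two : ∀ {ρ} → Simplex K m ρ → length (cofaces ρ) ≡ 2
  cofaces-two {ρ} ρ-simplex = IsPseudomanifold.thin pm m refl ρ ρ-simplex

  cofaces-unique : ∀ ρ → Unique (cofaces ρ)
  cofaces-unique ρ = Unique.filter⁺ (ρ ⊆?_) (simplices-unique (suc m))

  ∈-cofaces : ∀ {ρ σ} → Simplex K (suc m) σ → ρ ⊆ σ → σ ∈ cofaces ρ
  ∈-cofaces {ρ} σ-simplex ρ⊆σ = ∈-filter⁺ (ρ ⊆?_) (simplex-∈ σ-simplex) ρ⊆σ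

  cofaces-∈ : ∀ {ρ σ} → σ ∈ cofaces ρ → Simplex K (suc m) σ × ρ ⊆ σ
  cofaces-∈ {ρ} σ∈ with ∈-filter⁻ (ρ ⊆?_) {xs = Top} σ∈
  ... | σ∈Top , ρ⊆σ = ∈-simplex σ∈Top , ρ⊆σ

  d-δ-ridge : ∀ {ρ σ σ'} → Simplex K m ρ → σ ∈ cofaces ρ → σ' ∈ cofaces ρ → ¬ σ ≡ σ' →
              d K (δ ρ) ≗ₙ (λ x → δ σ x xor δ σ' x)
  d-δ-ridge {ρ} {σ} {σ'} ρ-simplex σ∈ σ'∈ σ≢σ' x x-simplex =
    trans (d-δ ρ-simplex x-simplex) (by-containment (ρ ⊆? x))
    where
    not-coface : ∀ {s} → ¬ ρ ⊆ x → s ∈ cofaces ρ → (x == s) ≡ false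
    not-coface ρ⊈x s∈ = ==-≢ (λ x≡s → ρ⊈x (subst (ρ ⊆_) (sym x≡s) (proj₂ (cofaces-∈ s∈))))
    by-containment : (ρ⊆?x : Dec (ρ ⊆ x)) → does ρ⊆?x ≡ (δ σ x xor δ σ' x)
    by-containment (yes ρ⊆x) with pair-exhaust (cofaces-two ρ-simplex) σ∈ σ'∈ σ≢σ' (∈-cofaces x-simplex ρ⊆x)
    ... | inj₁ refl = sym (cong₂ _xor_ (==-refl x) (==-≢ σ≢σ'))
    ... | inj₂ refl = sym (cong₂ _xor_ (==-≢ (λ σ'≡σ → σ≢σ' (sym σ'≡σ))) (==-refl x))
    by-containment (no ρ⊈x) = sym (cong₂ _xor_ (not-coface ρ⊈x σ∈) (not-coface ρ⊈x σ'∈))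

  adjacent-ridge : ∀ {σ τ} → Simplex K (suc m) σ → Simplex K (suc m) τ → Adjacent K (suc m) σ τ →
                   Simplex K m (σ ∩ τ) × d K (δ (σ ∩ τ)) ≗ₙ (λ x → δ σ x xor δ τ x)
  adjacent-ridge {σ} {τ} σ-simplex τ-simplex adj =
    ridge , d-δ-ridge ridge (∈-cofaces σ-simplex (p∩q⊆p σ τ)) (∈-cofaces τ-simplex (p∩q⊆q σ τ)) σ≢τ
    where
    ridge : Simplex K m (σ ∩ τ)
    ridge = closed K σ (σ ∩ τ) (proj₁ σ-simplex) (p∩q⊆p σ τ) (size-suc⇒nonempty _ adj) , adj
    σ≢τ : ¬ σ ≡ τ
    σ≢τ refl = 1+n≢n (suc-injective (trans (sym (proj₂ σ-simplex)) (trans (cong ∣_∣ (sym (∩-idem σ))) adj)))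

  -- A walk σ ⇝ τ of length k yields a cochain φ with dφ = δσ + δτ and
  -- ‖φ‖ ≤ k: the sum of the indicators of the ridges crossed.
  walk⇒cochain : ∀ {σ τ k} → Walk K (suc m) σ τ k → Simplex K (suc m) σ →
                 ∃[ φ ] (d K φ ≗ₙ (λ x → δ σ x xor δ τ x) × norm K m φ ≤ k)
  walk⇒cochain {σ} here _ =
    (λ _ → false) , (λ x _ → trans (d-zero x) (sym (xor-same (δ σ x)))) ,
    ≤-reflexive (count-zero _ Ridges (λ _ _ → refl))
  walk⇒cochain {σ} {τ} (step {τ = σ₁} {k = k} σ₁-simplex adj rest) σ-simplex
    with walk⇒cochain rest σ₁-simplex | adjacent-ridge σ-simplex σ₁-simplex adj
  ... | φ₁ , dφ₁ , ‖φ₁‖≤k | _ , dδ = φ , dφ , ‖φ‖≤1+k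
    where
    φ : Cochain K
    φ x = δ (σ ∩ σ₁) x xor φ₁ x
    dφ : d K φ ≗ₙ (λ x → δ σ x xor δ τ x)
    dφ x x-simplex = trans (d-xor (δ (σ ∩ σ₁)) φ₁ x)
      (trans (cong₂ _xor_ (dδ x x-simplex) (dφ₁ x x-simplex)) (xor-cancel-middle (δ σ x) (δ σ₁ x) (δ τ x)))
    ‖φ‖≤1+k : norm K m φ ≤ suc k
    ‖φ‖≤1+k = ≤-trans (count-xor (δ (σ ∩ σ₁)) φ₁ Ridges)
                      (+-mono-≤ (count-δ≤1 (σ ∩ σ₁) Ridges (simplices-unique m)) ‖φ₁‖≤k)

  -- One step of the converse: if dφ = δσ + δτ with σ ≠ τ, some ridge ρ of σ
  -- lies in supp φ; crossing it to the other coface σ' of ρ gives a cochain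
  -- φ + δρ of norm ‖φ‖ - 1 with coboundary δσ' + δτ.
  peel-ridge : ∀ (φ : Cochain K) {σ τ} → Simplex K (suc m) σ →
               d K φ ≗ₙ (λ x → δ σ x xor δ τ x) → ¬ σ ≡ τ →
               ∃[ σ' ] ∃[ φ' ] (Simplex K (suc m) σ' × Adjacent K (suc m) σ σ' ×
                 d K φ' ≗ₙ (λ x → δ σ' x xor δ τ x) × suc (norm K m φ') ≡ norm K m φ)
  peel-ridge φ {σ} {τ} σ-simplex dφ σ≢τ
    with xorSum-witness φ (facets K σ) (trans (dφ σ σ-simplex) (cong₂ _xor_ (==-refl σ) (==-≢ σ≢τ)))
  ... | ρ , ρ∈facets , φρ
    with pair-partner (cofaces-two (facet-simplex σ-simplex ρ∈facets)) (cofaces-unique ρ)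
                      (∈-cofaces σ-simplex (facet-⊆ ρ∈facets))
  ... | σ' , σ'∈ , σ≢σ' = σ' , φ' , proj₁ (cofaces-∈ σ'∈) , adj , dφ' , ‖φ'‖
    where
    ρ-simplex : Simplex K m ρ
    ρ-simplex = facet-simplex σ-simplex ρ∈facets
    σ∈ : σ ∈ cofaces ρ
    σ∈ = ∈-cofaces σ-simplex (facet-⊆ ρ∈facets)
    φ' : Cochain K
    φ' x = φ x xor δ ρ x
    adj : Adjacent K (suc m) σ σ'
    adj = shared-facet⇒adjacent (proj₂ ρ-simplex) (proj₂ σ-simplex) (proj₂ (proj₁ (cofaces-∈ σ'∈)))
            (facet-⊆ ρ∈facets) (proj₂ (cofaces-∈ σ'∈)) σ≢σ'
    dφ' : d K φ' ≗ₙ (λ x → δ σ' x xor δ τ x)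
    dφ' x x-simplex = trans (d-xor φ (δ ρ) x)
      (trans (cong₂ _xor_ (dφ x x-simplex) (d-δ-ridge ρ-simplex σ∈ σ'∈ σ≢σ' x x-simplex))
             (xor-cancel-left (δ σ x) (δ τ x) (δ σ' x)))
    ‖φ'‖ : suc (norm K m φ') ≡ norm K m φ
    ‖φ'‖ = count-remove φ Ridges (simplices-unique m) (simplex-∈ ρ-simplex) φρ

  -- Conversely, dφ = δσ + δτ yields a walk σ ⇝ τ of length ≤ ‖φ‖.
  -- (Recursion on N = ‖φ‖, which drops by one at each peeled ridge.)
  cochain⇒walk : ∀ N (φ : Cochain K) {σ τ} → norm K m φ ≡ N →
                 Simplex K (suc m) σ → Simplex K (suc m) τ → d K φ ≗ₙ (λ x → δ σ x xor δ τ x) →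
                 ∃[ k ] (k ≤ norm K m φ × Walk K (suc m) σ τ k)
  cochain⇒walk N φ {σ} {τ} ‖φ‖≡N σ-simplex τ-simplex dφ with σ ≟S τ
  ... | yes refl = 0 , z≤n , here
  ... | no σ≢τ with peel-ridge φ σ-simplex dφ σ≢τ
  cochain⇒walk zero φ ‖φ‖≡0 _ _ _ | no _ | _ , _ , _ , _ , _ , ‖φ'‖ =
    ⊥-elim (1+n≢0 (trans ‖φ'‖ ‖φ‖≡0))
  cochain⇒walk (suc N) φ ‖φ‖≡1+N _ τ-simplex _ | no _ | σ' , φ' , σ'-simplex , adj , dφ' , ‖φ'‖
    with cochain⇒walk N φ' (suc-injective (trans ‖φ'‖ ‖φ‖≡1+N)) σ'-simplex τ-simplex dφ'
  ... | k , k≤‖φ'‖ , walk = suc k , ≤-trans (s≤s k≤‖φ'‖) (≤-reflexive ‖φ'‖) , step σ'-simplex adj walk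

  -- Σ_τ d(δρ)(τ) = 0 for a ridge ρ: it has exactly two cofaces.
  xorSum-d-δ : ∀ {ρ} → Simplex K m ρ → xorSum (d K (δ ρ)) Top ≡ false
  xorSum-d-δ {ρ} ρ-simplex with pair-members (cofaces-two ρ-simplex) (cofaces-unique ρ)
  ... | a , b , a∈ , b∈ , a≢b = begin
      xorSum (d K (δ ρ)) Top
    ≡⟨ xorSum-cong Top (λ x x∈ → d-δ-ridge ρ-simplex a∈ b∈ a≢b x (∈-simplex x∈)) ⟩
      xorSum (λ x → δ a x xor δ b x) Top
    ≡⟨ sym (parity-count _ Top) ⟩
      parity (count (λ x → δ a x xor δ b x) Top)
    ≡⟨ cong parity (count-δ-pair Top (simplices-unique (suc m))
                      (simplex-∈ (proj₁ (cofaces-∈ a∈))) (simplex-∈ (proj₁ (cofaces-∈ b∈))) a≢b) ⟩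
      false
    ∎
    where open ≡-Reasoning

  xorSum-d-χ : ∀ L → (∀ ρ → ρ ∈ L → Simplex K m ρ) → xorSum (d K (χ L)) Top ≡ false
  xorSum-d-χ [] _ = xorSum-zero _ Top (λ x _ → d-zero x)
  xorSum-d-χ (ρ ∷ L) ridges = begin
      xorSum (d K (χ (ρ ∷ L))) Top
    ≡⟨ xorSum-cong Top (λ x _ → d-xor (δ ρ) (χ L) x) ⟩
      xorSum (λ x → d K (δ ρ) x xor d K (χ L) x) Top
    ≡⟨ xorSum-xor _ _ Top ⟩
      xorSum (d K (δ ρ)) Top xor xorSum (d K (χ L)) Top
    ≡⟨ cong₂ _xor_ (xorSum-d-δ (ridges ρ (here refl))) (xorSum-d-χ L (λ ρ' ρ'∈ → ridges ρ' (there ρ'∈))) ⟩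
      false
    ∎
    where open ≡-Reasoning

  -- Every coboundary of an (n-1)-cochain has even norm: φ agrees on ridges
  -- with the indicator of its support.
  norm-d-even : ∀ φ → parity (norm K (suc m) (d K φ)) ≡ false
  norm-d-even φ = begin
      parity (norm K (suc m) (d K φ))
    ≡⟨ parity-count (d K φ) Top ⟩
      xorSum (d K φ) Top
    ≡⟨ xorSum-cong Top (λ x x∈ → d-local φ≗χ (∈-simplex x∈)) ⟩
      xorSum (d K (χ support)) Top
    ≡⟨ xorSum-d-χ support (λ _ → support-simplex φ) ⟩
      false
    ∎
    where
    open ≡-Reasoning
    support : List (Subset V)
    support = filterᵇ φ Ridges
    φ≗χ : ∀ ρ → Simplex K m ρ → φ ρ ≡ χ support ρ
    φ≗χ ρ ρ-simplex = sym (χ-support φ Ridges (simplices-unique m) (simplex-∈ ρ-simplex))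

  d-⊕-coboundary : ∀ φ ψ → d K (_⊕_ K φ (d K ψ)) ≗ₙ d K φ
  d-⊕-coboundary φ ψ x (face , size) =
    trans (d-xor φ (d K ψ) x) (trans (cong (d K φ x xor_) (d∘d ψ x face size)) (xor-identityʳ _))

  far-apart⇒norm-≥ : ∀ {D σ τ} → Simplex K (suc m) σ → Simplex K (suc m) τ →
                     (∀ k → Walk K (suc m) σ τ k → D ≤ k) →
                     ∀ φ → d K φ ≗ₙ (λ x → δ σ x xor δ τ x) → D ≤ norm K m φ
  far-apart⇒norm-≥ σ-simplex τ-simplex far φ dφ with cochain⇒walk _ φ refl σ-simplex τ-simplex dφ
  ... | k , k≤‖φ‖ , walk = ≤-trans (far k walk) k≤‖φ‖

  -- A pseudomanifold of dimension ≥ 1 has two distinct n-simplices: those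
  -- on either side of any ridge.
  two-top-simplices : ∃[ σ ] ∃[ σ' ] (Simplex K (suc m) σ × Simplex K (suc m) σ' × ¬ σ ≡ σ')
  two-top-simplices with IsPseudomanifold.hasTop pm
  ... | σ , σ-simplex@(face , size) with size-suc⇒nonempty σ size
  ... | i , i∈σ with pair-partner (cofaces-two ridge) (cofaces-unique (σ - i)) (∈-cofaces σ-simplex (p-i⊆p σ i))
    where
    ridge : Simplex K m (σ - i)
    ridge = Equivalence.from T-≡ (face-minus i face size (∈⇒lookup i∈σ)) ,
            suc-injective (trans (∣p-i∣ σ i (∈⇒lookup i∈σ)) size)
  ... | σ' , σ'∈ , σ≢σ' = σ , σ' , σ-simplex , proj₁ (cofaces-∈ σ'∈) , σ≢σ'

  module WithinDistance (D : ℕ)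
    (reach : ∀ σ τ → Simplex K (suc m) σ → Simplex K (suc m) τ → ∃[ k ] (k ≤ D × Walk K (suc m) σ τ k)) where

    -- An even list S of n-simplices is the coboundary of a cochain of norm
    -- ≤ D·|S|/2: join consecutive pairs by walks of length ≤ D.
    pairing : ∀ S → (∀ s → s ∈ S → Simplex K (suc m) s) → parity (length S) ≡ false →
              ∃[ φ ] (d K φ ≗ₙ χ S × 2 * norm K m φ ≤ D * length S)
    pairing [] _ _ =
      (λ _ → false) , (λ x _ → d-zero x) ,
      ≤-reflexive (trans (cong (2 *_) (count-zero _ Ridges (λ _ _ → refl))) (sym (*-zeroʳ D)))
    pairing (_ ∷ []) _ ()
    pairing (s₁ ∷ s₂ ∷ S) tops even
      with reach s₁ s₂ (tops s₁ (here refl)) (tops s₂ (there (here refl)))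
    ... | k , k≤D , walk
      with walk⇒cochain walk (tops s₁ (here refl))
         | pairing S (λ s s∈ → tops s (there (there s∈))) (trans (sym (not-involutive _)) even)
    ... | φ₁ , dφ₁ , ‖φ₁‖≤k | φ₂ , dφ₂ , ‖φ₂‖≤ = (λ x → φ₁ x xor φ₂ x) , dφ , bound
      where
      dφ : d K (λ x → φ₁ x xor φ₂ x) ≗ₙ χ (s₁ ∷ s₂ ∷ S)
      dφ x x-simplex = trans (d-xor φ₁ φ₂ x)
        (trans (cong₂ _xor_ (dφ₁ x x-simplex) (dφ₂ x x-simplex)) (xor-assoc (x == s₁) (x == s₂) (χ S x)))
      bound : 2 * norm K m (λ x → φ₁ x xor φ₂ x) ≤ D * suc (suc (length S))
      bound = begin
          2 * norm K m (λ x → φ₁ x xor φ₂ x)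
        ≤⟨ *-monoʳ-≤ 2 (≤-trans (count-xor φ₁ φ₂ Ridges) (+-monoˡ-≤ (norm K m φ₂) ‖φ₁‖≤k)) ⟩
          2 * (k + norm K m φ₂)
        ≡⟨ *-distribˡ-+ 2 k (norm K m φ₂) ⟩
          2 * k + 2 * norm K m φ₂
        ≤⟨ +-mono-≤ (*-monoʳ-≤ 2 k≤D) ‖φ₂‖≤ ⟩
          2 * D + D * length S
        ≡⟨ cong (_+ D * length S) (*-comm 2 D) ⟩
          D * 2 + D * length S
        ≡⟨ sym (*-distribˡ-+ D 2 (length S)) ⟩
          D * suc (suc (length S))
        ∎
        where open ≤-Reasoning

    -- Lower bound: ‖φ‖_csy ≤ (D/2)‖dφ‖.  The pairing cochain φ' of supp(dφ)
    -- makes φ + φ' a cocycle, hence a coboundary dψ, and ‖φ + dψ‖ = ‖φ'‖.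
    csy-lower-bound : VanishingCohomology K m → ∀ φ M → IsCsyNorm K m φ M →
                      2 * M ≤ D * norm K (suc m) (d K φ)
    csy-lower-bound vanishing φ M (_ , minimal)
      with pairing (filterᵇ (d K φ) Top) (λ _ → support-simplex (d K φ)) (norm-d-even φ)
    ... | φ' , dφ' , ‖φ'‖≤ with vanishing (λ x → φ x xor φ' x) cocycle
      where
      cocycle : IsCocycle K m (λ x → φ x xor φ' x)
      cocycle τ τ-simplex = trans (d-xor φ φ' τ)
        (trans (cong (d K φ τ xor_) (trans (dφ' τ τ-simplex)
                  (χ-support (d K φ) Top (simplices-unique (suc m)) (simplex-∈ τ-simplex))))
               (xor-same (d K φ τ)))
    ... | ψ , φ⊕φ'≗dψ =
      ≤-trans (*-monoʳ-≤ 2 (≤-trans (minimal ψ) (≤-reflexive ‖φ⊕dψ‖≡‖φ'‖))) ‖φ'‖≤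
      where
      ‖φ⊕dψ‖≡‖φ'‖ : norm K m (_⊕_ K φ (d K ψ)) ≡ norm K m φ'
      ‖φ⊕dψ‖≡‖φ'‖ = count-cong Ridges (λ ρ ρ∈ → begin
          φ ρ xor d K ψ ρ          ≡⟨ cong (φ ρ xor_) (sym (φ⊕φ'≗dψ ρ (∈-simplex ρ∈))) ⟩
          φ ρ xor (φ ρ xor φ' ρ)   ≡⟨ sym (xor-assoc (φ ρ) (φ ρ) (φ' ρ)) ⟩
          (φ ρ xor φ ρ) xor φ' ρ   ≡⟨ cong (_xor φ' ρ) (xor-same (φ ρ)) ⟩
          φ' ρ                     ∎)
        where open ≡-Reasoning

    diameter-nonzero : ¬ D ≡ 0
    diameter-nonzero D≡0 with two-top-simplices
    ... | σ , σ' , σ-simplex , σ'-simplex , σ≢σ' with reach σ σ' σ-simplex σ'-simplex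
    ... | k , k≤D , walk with n≤0⇒n≡0 (subst (k ≤_) D≡0 k≤D)
    ... | refl with walk
    ...   | here = σ≢σ' refl

    -- Attainment: for σ₀, τ₀ at distance D, the cochain φ of a shortest walk
    -- has ‖dφ‖ = 2 and ‖φ‖_csy = D, since every φ + dψ still has coboundary
    -- δσ₀ + δτ₀ and hence norm ≥ D.
    csy-attained : ∀ {σ₀ τ₀} → Simplex K (suc m) σ₀ → Simplex K (suc m) τ₀ →
                   (∀ k → Walk K (suc m) σ₀ τ₀ k → D ≤ k) →
                   ∃[ φ ] (¬ IsCoboundary K m φ × ∃[ M ] (IsCsyNorm K m φ M × 2 * M ≡ D * norm K (suc m) (d K φ)))
    csy-attained {σ₀} {τ₀} σ₀-simplex τ₀-simplex far with reach σ₀ τ₀ σ₀-simplex τ₀-simplex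
    ... | k , k≤D , walk with walk⇒cochain walk σ₀-simplex
    ... | φ , dφ , ‖φ‖≤k = φ , not-coboundary , D , ((no-shift , ‖φ⊕d0‖≡D) , shifted-≥) , ‖dφ‖
      where
      shifted-≥ : ∀ ψ → D ≤ norm K m (_⊕_ K φ (d K ψ))
      shifted-≥ ψ = far-apart⇒norm-≥ σ₀-simplex τ₀-simplex far _
                      (λ x x-simplex → trans (d-⊕-coboundary φ ψ x x-simplex) (dφ x x-simplex))
      no-shift : Cochain K
      no-shift _ = false
      ‖φ⊕d0‖≡D : norm K m (_⊕_ K φ (d K no-shift)) ≡ D
      ‖φ⊕d0‖≡D = ≤-antisym
        (≤-trans (≤-reflexive (count-cong Ridges (λ x _ → trans (cong (φ x xor_) (d-zero x)) (xor-identityʳ (φ x)))))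
                 (≤-trans ‖φ‖≤k k≤D))
        (shifted-≥ no-shift)
      not-coboundary : ¬ IsCoboundary K m φ
      not-coboundary (ψ , φ≗dψ) = diameter-nonzero (n≤0⇒n≡0 (≤-trans (shifted-≥ ψ) (≤-reflexive
        (count-zero _ Ridges (λ x x∈ → trans (cong (_xor d K ψ x) (φ≗dψ x (∈-simplex x∈))) (xor-same (d K ψ x)))))))
      σ₀≢τ₀ : ¬ σ₀ ≡ τ₀
      σ₀≢τ₀ refl = diameter-nonzero (n≤0⇒n≡0 (far 0 here))
      ‖dφ‖ : 2 * D ≡ D * norm K (suc m) (d K φ)
      ‖dφ‖ = trans (*-comm 2 D) (cong (D *_) (sym (trans (count-cong Top (λ x x∈ → dφ x (∈-simplex x∈)))
               (count-δ-pair Top (simplices-unique (suc m)) (simplex-∈ σ₀-simplex) (simplex-∈ τ₀-simplex) σ₀≢τ₀))))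

theorem3p3 : ∀ {V : ℕ} (X : Complex V) (m : ℕ) →
    IsPseudomanifold X (suc m) →
    VanishingCohomology X m →
    ∀ D → IsDiameter X (suc m) D →
    CheegerIs X m 2 D
theorem3p3 X m pm vanishing D (reach , σ₀ , τ₀ , σ₀-simplex , τ₀-simplex , far) =
  (λ φ _ → csy-lower-bound vanishing φ) , csy-attained σ₀-simplex τ₀-simplex far
  where open Pseudomanifold X m pm
        open WithinDistance D reach
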